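{- Let $C\subset\mathbb{Z}_2^n$ be a cap. Then $\mathrm{exc}(C)$ contains a point of multiplicity at least $2$ if and only if $C$ contains six points that lie in a $4$-flat.
   Context: $\mathbb{Z}_2^n$ is the $n$-dimensional vector space over $\mathbb{Z}_2$. A quad is a set of four distinct elements $a,b,c,d$ with $a+b+c+d=\vec 0$; a cap is a subset containing no quad. For $S\subset\mathbb{Z}_2^n$, $\mathrm{exc}(S)=\{a+b+c: a,b,c\in S\text{ distinct}\}$; the multiplicity of $p\in\mathrm{exc}(S)$ is the number of $3$-element subsets $\{x,y,z\}\subset S$ with $x+y+z=p$. A $4$-flat is a $4$-dimensional affine subspace of $\mathbb{Z}_2^n$. -}

module Defs where

open import Data.Bool using (Bool; true; false; _xor_; if_then_else_)
open import Data.Nat using (ℕ; zero; suc)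
open import Data.Fin using (Fin; zero; suc)
open import Data.Vec using (Vec; zipWith; replicate)
open import Data.Product using (Σ; ∃; _×_; _,_)
open import Data.Sum using (_⊎_)
open import Relation.Binary.PropositionalEquality using (_≡_; _≢_)
open import Relation.Nullary using (¬_)
open import Function.Definitions using (Injective)

Z2^ : ℕ → Set
Z2^ n = Vec Bool n

infixl 6 _⊕_
_⊕_ : ∀ {n} → Z2^ n → Z2^ n → Z2^ n
_⊕_ = zipWith _xor_

𝟎 : ∀ {n} → Z2^ n
𝟎 = replicate _ false

-- a subset of Z₂ⁿ (finite automatically, as Z₂ⁿ is finite)
Subset : ℕ → Set₁
Subset n = Z2^ n → Set

IsQuad : ∀ {n} → Z2^ n → Z2^ n → Z2^ n → Z2^ n → Set
IsQuad a b c d =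
  a ≢ b × a ≢ c × a ≢ d × b ≢ c × b ≢ d × c ≢ d × (a ⊕ b ⊕ c ⊕ d ≡ 𝟎)

IsCap : ∀ {n} → Subset n → Set
IsCap {n} S = (a b c d : Z2^ n) → S a → S b → S c → S d → ¬ IsQuad a b c d

-- a 3-element subset {x,y,z} of S (given by three distinct elements of S)
record Triple {n} (S : Subset n) : Set where
  constructor triple
  field
    x y z : Z2^ n
    x∈ : S x
    y∈ : S y
    z∈ : S z
    x≢y : x ≢ y
    x≢z : x ≢ z
    y≢z : y ≢ z

_∈T_ : ∀ {n} {S : Subset n} → Z2^ n → Triple S → Set
w ∈T triple x y z _ _ _ _ _ _ = (w ≡ x) ⊎ (w ≡ y) ⊎ (w ≡ z)

SameSet : ∀ {n} {S : Subset n} → Triple S → Triple S → Set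
SameSet {n} s t = ((w : Z2^ n) → w ∈T s → w ∈T t) × ((w : Z2^ n) → w ∈T t → w ∈T s)

sumT : ∀ {n} {S : Subset n} → Triple S → Z2^ n
sumT (triple x y z _ _ _ _ _ _) = x ⊕ y ⊕ z

-- p ∈ exc(S) has multiplicity ≥ 2: two different 3-subsets of S sum to p
MultAtLeast2 : ∀ {n} → Subset n → Z2^ n → Set
MultAtLeast2 S p =
  Σ (Triple S) λ s → Σ (Triple S) λ t →
    (sumT s ≡ p) × (sumT t ≡ p) × ¬ SameSet s t

lincomb : ∀ {n k} → (Fin k → Bool) → (Fin k → Z2^ n) → Z2^ n
lincomb {k = zero}  λs u = 𝟎
lincomb {k = suc k} λs u =
  (if λs zero then u zero else 𝟎) ⊕ lincomb (λ i → λs (suc i)) (λ i → u (suc i))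

LinIndep : ∀ {n k} → (Fin k → Z2^ n) → Set
LinIndep {k = k} u = (λs : Fin k → Bool) → lincomb λs u ≡ 𝟎 → (i : Fin k) → λs i ≡ false

InFlat : ∀ {n k} → Z2^ n → (Fin k → Z2^ n) → Z2^ n → Set
InFlat {k = k} v u w = Σ (Fin k → Bool) λ λs → w ≡ v ⊕ lincomb λs u

SixInFourFlat : ∀ {n} → Subset n → Set
SixInFourFlat {n} S =
  Σ (Z2^ n) λ v → Σ (Fin 4 → Z2^ n) λ u → LinIndep u ×
    Σ (Fin 6 → Z2^ n) λ pts → Injective _≡_ _≡_ pts ×
      ((i : Fin 6) → S (pts i)) × ((i : Fin 6) → InFlat v u (pts i))

-- Two different 3-subsets of a cap with the same sum are disjoint: if they shared a point, the
-- remaining pairs would have equal sums, and in a cap equal pair sums force equal pairs.  Hence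
-- they consist of six distinct points x, y, z, a, b, c with x + y + z + a + b + c = 0, all in
-- the 4-flat x + ⟨y + x, z + x, a + x, b + x⟩; the four directions are independent because a
-- dependency would be a vanishing sum of two or four distinct points among x, y, z, a, b.
-- Conversely, the sums of the twenty 3-subsets of six points of a 4-flat lie in that flat,
-- which has only sixteen points, so two of them coincide.
module Submission where

open import Algebra.Bundles using (CommutativeSemigroup)
open import Data.Bool using (Bool; true; false; _xor_; if_then_else_)
open import Data.Bool.Properties
  using (xor-assoc; xor-comm; xor-identityˡ; xor-identityʳ; xor-same) renaming (_≟_ to _≟ᵇ_)
open import Data.Empty using (⊥-elim)
open import Data.Fin using (Fin; zero; suc; inject₁; funToFin; finToFun) renaming (_<_ to _<ᶠ_)
open import Data.Fin.Patterns using (0F; 1F; 2F; 3F; 4F; 5F)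
open import Data.Fin.Properties
  using (inject₁-injective; <⇒≢; 2↔Bool; finToFun-funToFin; pigeonhole; all?; any?)
  renaming (_≟_ to _≟ᶠ_)
open import Data.Nat using (ℕ; zero; suc; _^_; _<_; _<?_)
open import Data.Product using (Σ; _×_; _,_; proj₁; proj₂; ∃₂)
open import Data.Sum using (_⊎_; inj₁; inj₂; [_,_])
import Data.Sum as Sum
open import Data.Vec using (Vec; []; _∷_; lookup; zipWith; replicate; tabulate; _[_]≔_)
open import Data.Vec.Properties
  using (zipWith-assoc; zipWith-comm; zipWith-identityˡ; zipWith-identityʳ; zipWith-inverseˡ;
         map-id; lookup-zipWith; lookup-replicate; lookup∘tabulate)
  renaming (≡-dec to Vec-≡-dec)
open import Data.Vec.Relation.Unary.All using (All; []; _∷_)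
open import Data.Vec.Relation.Unary.All.Properties using (lookup⁺)
open import Data.Vec.Relation.Unary.AllPairs using ([]; _∷_; allPairs?)
open import Data.Vec.Relation.Unary.Unique.Propositional using (Unique)
open import Data.Vec.Relation.Unary.Unique.Propositional.Properties using (lookup-injective)
open import Function using (_∘_)
open import Function.Bundles using (Inverse)
open import Function.Definitions using (Injective)
open import Relation.Binary.Definitions using (DecidableEquality)
open import Relation.Binary.PropositionalEquality
  using (_≡_; _≢_; refl; sym; trans; cong; cong₂; subst; ≢-sym; module ≡-Reasoning)
open import Relation.Binary.PropositionalEquality.Algebra using (isMagma)
open import Relation.Nullary using (¬_; Dec; yes; no)
open import Relation.Nullary.Decidable
  using (True; False; toWitness; toWitnessFalse; from-yes; ¬?; _×-dec_; _⊎-dec_)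

open import Defs

module _ {n : ℕ} where

  ⊕-assoc : (a b c : Z2^ n) → a ⊕ b ⊕ c ≡ a ⊕ (b ⊕ c)
  ⊕-assoc = zipWith-assoc xor-assoc

  ⊕-comm : (a b : Z2^ n) → a ⊕ b ≡ b ⊕ a
  ⊕-comm = zipWith-comm xor-comm

  ⊕-identityˡ : (a : Z2^ n) → 𝟎 ⊕ a ≡ a
  ⊕-identityˡ = zipWith-identityˡ xor-identityˡ

  ⊕-identityʳ : (a : Z2^ n) → a ⊕ 𝟎 ≡ a
  ⊕-identityʳ = zipWith-identityʳ xor-identityʳ

  ⊕-self : (a : Z2^ n) → a ⊕ a ≡ 𝟎
  ⊕-self a = trans (cong (_⊕ a) (sym (map-id a))) (zipWith-inverseˡ xor-same a)

  ⊕-commutativeSemigroup : CommutativeSemigroup _ _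
  ⊕-commutativeSemigroup = record
    { Carrier = Z2^ n
    ; _≈_ = _≡_
    ; _∙_ = _⊕_
    ; isCommutativeSemigroup = record
      { isSemigroup = record { isMagma = isMagma _⊕_ ; assoc = ⊕-assoc }
      ; comm = ⊕-comm
      }
    }

  open import Algebra.Properties.CommutativeSemigroup ⊕-commutativeSemigroup
    using () renaming (interchange to ⊕-interchange)

  if-xor : (b c : Bool) (a : Z2^ n) →
           (if b xor c then a else 𝟎) ≡ (if b then a else 𝟎) ⊕ (if c then a else 𝟎)
  if-xor false false a = sym (⊕-self 𝟎)
  if-xor false true  a = sym (⊕-identityˡ a)
  if-xor true  false a = sym (⊕-identityʳ a)
  if-xor true  true  a = sym (⊕-self a)

  lincomb-cong : ∀ {k} {λs μs : Fin k → Bool} (u : Fin k → Z2^ n) →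
                 (∀ i → λs i ≡ μs i) → lincomb λs u ≡ lincomb μs u
  lincomb-cong {zero}  u eq = refl
  lincomb-cong {suc k} u eq =
    cong₂ _⊕_ (cong (λ b → if b then u zero else 𝟎) (eq zero))
              (lincomb-cong (λ i → u (suc i)) (λ i → eq (suc i)))

  lincomb-xor : ∀ {k} (λs μs : Fin k → Bool) (u : Fin k → Z2^ n) →
                lincomb (λ i → λs i xor μs i) u ≡ lincomb λs u ⊕ lincomb μs u
  lincomb-xor {zero}  λs μs u = sym (⊕-self 𝟎)
  lincomb-xor {suc k} λs μs u =
    trans (cong₂ _⊕_ (if-xor (λs zero) (μs zero) (u zero))
                     (lincomb-xor (λ i → λs (suc i)) (λ i → μs (suc i)) (λ i → u (suc i))))
          (⊕-interchange _ _ _ _)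

  lincomb-false : ∀ {k} (u : Fin k → Z2^ n) → lincomb (λ _ → false) u ≡ 𝟎
  lincomb-false {zero}  u = refl
  lincomb-false {suc k} u = trans (⊕-identityˡ _) (lincomb-false (λ i → u (suc i)))

  lincomb-zeros : ∀ {k} (u : Fin k → Z2^ n) → lincomb (lookup (replicate k false)) u ≡ 𝟎
  lincomb-zeros u = trans (lincomb-cong u (λ i → lookup-replicate i false)) (lincomb-false u)

  lincomb-unit : ∀ {k} (i : Fin k) (u : Fin k → Z2^ n) →
                 lincomb (lookup (replicate k false [ i ]≔ true)) u ≡ u i
  lincomb-unit zero    u = trans (cong (u zero ⊕_) (lincomb-zeros (λ i → u (suc i)))) (⊕-identityʳ _)
  lincomb-unit (suc i) u = trans (⊕-identityˡ _) (lincomb-unit i (λ j → u (suc j)))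

infixl 6 _⊞_
data Expr (k : ℕ) : Set where
  var : Fin k → Expr k
  nil : Expr k
  _⊞_ : Expr k → Expr k → Expr k

⟦_⟧ : ∀ {n k} → Expr k → (Fin k → Z2^ n) → Z2^ n
⟦ var i ⟧ ρ = ρ i
⟦ nil   ⟧ ρ = 𝟎
⟦ e ⊞ f ⟧ ρ = ⟦ e ⟧ ρ ⊕ ⟦ f ⟧ ρ

normalise : ∀ {k} → Expr k → Vec Bool k
normalise (var i) = replicate _ false [ i ]≔ true
normalise nil     = replicate _ false
normalise (e ⊞ f) = zipWith _xor_ (normalise e) (normalise f)

normalise-sound : ∀ {n k} (e : Expr k) (ρ : Fin k → Z2^ n) → ⟦ e ⟧ ρ ≡ lincomb (lookup (normalise e)) ρ
normalise-sound (var i) ρ = sym (lincomb-unit i ρ)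
normalise-sound nil     ρ = sym (lincomb-zeros ρ)
normalise-sound (e ⊞ f) ρ = begin
  ⟦ e ⟧ ρ ⊕ ⟦ f ⟧ ρ
    ≡⟨ cong₂ _⊕_ (normalise-sound e ρ) (normalise-sound f ρ) ⟩
  lincomb (lookup (normalise e)) ρ ⊕ lincomb (lookup (normalise f)) ρ
    ≡⟨ sym (lincomb-xor (lookup (normalise e)) (lookup (normalise f)) ρ) ⟩
  lincomb (λ i → lookup (normalise e) i xor lookup (normalise f) i) ρ
    ≡⟨ lincomb-cong ρ (λ i → sym (lookup-zipWith _xor_ i (normalise e) (normalise f))) ⟩
  lincomb (lookup (normalise (e ⊞ f))) ρ ∎
  where open ≡-Reasoning

⊕-solve : ∀ {n k} (e f : Expr k) → normalise e ≡ normalise f → (ρ : Fin k → Z2^ n) → ⟦ e ⟧ ρ ≡ ⟦ f ⟧ ρ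
⊕-solve e f eq ρ =
  trans (normalise-sound e ρ) (trans (cong (λ σ → lincomb (lookup σ) ρ) eq) (sym (normalise-sound f ρ)))

module _ {n : ℕ} where

  ⊕-cancelˡ : (a : Z2^ n) {b c : Z2^ n} → a ⊕ b ≡ a ⊕ c → b ≡ c
  ⊕-cancelˡ a {b} {c} eq = begin
    b             ≡⟨ sym (⊕-absorb a b) ⟩
    a ⊕ (a ⊕ b)   ≡⟨ cong (a ⊕_) eq ⟩
    a ⊕ (a ⊕ c)   ≡⟨ ⊕-absorb a c ⟩
    c             ∎
    where
    open ≡-Reasoning
    ⊕-absorb : (x y : Z2^ n) → x ⊕ (x ⊕ y) ≡ y
    ⊕-absorb x y = ⊕-solve (var 0F ⊞ (var 0F ⊞ var 1F)) (var 1F) refl (lookup (x ∷ y ∷ []))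

  ⊕≡𝟎⇒≡ : {a b : Z2^ n} → a ⊕ b ≡ 𝟎 → a ≡ b
  ⊕≡𝟎⇒≡ {a} eq = sym (⊕-cancelˡ a (trans eq (sym (⊕-self a))))

pattern 1st = inj₁ refl
pattern 2nd = inj₂ (inj₁ refl)
pattern 3rd = inj₂ (inj₂ refl)

module _ {n : ℕ} {S : Subset n} where

  swap₁₂ swap₁₃ : Triple S → Triple S
  swap₁₂ (triple x y z x∈ y∈ z∈ x≢y x≢z y≢z) = triple y x z y∈ x∈ z∈ (≢-sym x≢y) y≢z x≢z
  swap₁₃ (triple x y z x∈ y∈ z∈ x≢y x≢z y≢z) = triple z y x z∈ y∈ x∈ (≢-sym y≢z) (≢-sym x≢z) (≢-sym x≢y)

  sumT-swap₁₂ : (t : Triple S) → sumT (swap₁₂ t) ≡ sumT t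
  sumT-swap₁₂ (triple x y z _ _ _ _ _ _) = cong (_⊕ z) (⊕-comm y x)

  sumT-swap₁₃ : (t : Triple S) → sumT (swap₁₃ t) ≡ sumT t
  sumT-swap₁₃ (triple x y z _ _ _ _ _ _) =
    ⊕-solve (var 2F ⊞ var 1F ⊞ var 0F) (var 0F ⊞ var 1F ⊞ var 2F) refl (lookup (x ∷ y ∷ z ∷ []))

  SameSet-sym : {s t : Triple S} → SameSet s t → SameSet t s
  SameSet-sym (s⊆t , t⊆s) = t⊆s , s⊆t

  SameSet-trans : {s t u : Triple S} → SameSet s t → SameSet t u → SameSet s u
  SameSet-trans (s⊆t , t⊆s) (t⊆u , u⊆t) = (λ w → t⊆u w ∘ s⊆t w) , (λ w → t⊆s w ∘ u⊆t w)

  SameSet-swap₁₂ : (t : Triple S) → SameSet t (swap₁₂ t)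
  SameSet-swap₁₂ (triple _ _ _ _ _ _ _ _ _) = (λ _ → swap₁₂-⊎) , (λ _ → swap₁₂-⊎)
    where
    swap₁₂-⊎ : ∀ {A B C : Set} → A ⊎ B ⊎ C → B ⊎ A ⊎ C
    swap₁₂-⊎ = [ inj₂ ∘ inj₁ , [ inj₁ , inj₂ ∘ inj₂ ] ]

  SameSet-swap₁₃ : (t : Triple S) → SameSet t (swap₁₃ t)
  SameSet-swap₁₃ (triple _ _ _ _ _ _ _ _ _) = (λ _ → swap₁₃-⊎) , (λ _ → swap₁₃-⊎)
    where
    swap₁₃-⊎ : ∀ {A B C : Set} → A ⊎ B ⊎ C → C ⊎ B ⊎ A
    swap₁₃-⊎ = [ inj₂ ∘ inj₂ , [ inj₂ ∘ inj₁ , inj₁ ] ]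

  rotate-to-front : (t : Triple S) {w : Z2^ n} → w ∈T t →
                    Σ (Triple S) λ t′ → Triple.x t′ ≡ w × sumT t′ ≡ sumT t × SameSet t t′
  rotate-to-front t@(triple _ _ _ _ _ _ _ _ _) 1st =
    t , refl , refl , (λ _ m → m) , (λ _ m → m)
  rotate-to-front t@(triple _ _ _ _ _ _ _ _ _) 2nd =
    swap₁₂ t , refl , sumT-swap₁₂ t , SameSet-swap₁₂ t
  rotate-to-front t@(triple _ _ _ _ _ _ _ _ _) 3rd =
    swap₁₃ t , refl , sumT-swap₁₃ t , SameSet-swap₁₃ t

_≟_ : ∀ {n} → DecidableEquality (Z2^ n)
_≟_ = Vec-≡-dec _≟ᵇ_

module _ {n : ℕ} {C : Subset n} (cap : IsCap C) where

  cap-pair-sum-injective : {y z b c : Z2^ n} → C y → C z → C b → C c → y ≢ z → b ≢ c →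
                           y ⊕ z ≡ b ⊕ c → (y ≡ b × z ≡ c) ⊎ (y ≡ c × z ≡ b)
  cap-pair-sum-injective {y} {z} {b} {c} y∈ z∈ b∈ c∈ y≢z b≢c eq with y ≟ b | y ≟ c
  ... | yes refl | _        = inj₁ (refl , ⊕-cancelˡ y eq)
  ... | no _     | yes refl = inj₂ (refl , ⊕-cancelˡ y (trans eq (⊕-comm b y)))
  ... | no y≢b   | no y≢c   = ⊥-elim (cap y z b c y∈ z∈ b∈ c∈ (y≢z , y≢b , y≢c , z≢b , z≢c , b≢c , quad-sum))
    where
    z≢b : z ≢ b
    z≢b z≡b = y≢c (⊕-cancelˡ b (trans (⊕-comm b y) (trans (cong (y ⊕_) (sym z≡b)) eq)))
    z≢c : z ≢ c
    z≢c z≡c = y≢b (⊕-cancelˡ c (trans (⊕-comm c y) (trans (cong (y ⊕_) (sym z≡c)) (trans eq (⊕-comm b c)))))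
    quad-sum : y ⊕ z ⊕ b ⊕ c ≡ 𝟎
    quad-sum = trans (⊕-assoc (y ⊕ z) b c) (trans (cong (_⊕ (b ⊕ c)) eq) (⊕-self (b ⊕ c)))

  cap-same-front : (s t : Triple C) → Triple.x s ≡ Triple.x t → sumT s ≡ sumT t → SameSet s t
  cap-same-front (triple w y z _ y∈ z∈ _ _ y≢z) (triple .w b c _ b∈ c∈ _ _ b≢c) refl eq
    with cap-pair-sum-injective y∈ z∈ b∈ c∈ y≢z b≢c
           (⊕-cancelˡ w (trans (sym (⊕-assoc w y z)) (trans eq (⊕-assoc w b c))))
  ... | inj₁ (refl , refl) = (λ _ m → m) , (λ _ m → m)
  ... | inj₂ (refl , refl) = (λ _ → swap₂₃-⊎) , (λ _ → swap₂₃-⊎)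
    where
    swap₂₃-⊎ : ∀ {A B C : Set} → A ⊎ B ⊎ C → A ⊎ C ⊎ B
    swap₂₃-⊎ = [ inj₁ , [ inj₂ ∘ inj₂ , inj₂ ∘ inj₁ ] ]

  cap-shared-point⇒SameSet : (s t : Triple C) {w : Z2^ n} → w ∈T s → w ∈T t → sumT s ≡ sumT t → SameSet s t
  cap-shared-point⇒SameSet s t w∈s w∈t eq with rotate-to-front s w∈s | rotate-to-front t w∈t
  ... | s′ , s′₁≡w , Σs′≡Σs , s≈s′ | t′ , t′₁≡w , Σt′≡Σt , t≈t′ =
    SameSet-trans {s = s} {s′} {t} s≈s′ (SameSet-trans {s = s′} {t′} {t} s′≈t′ (SameSet-sym {s = t} {t′} t≈t′))
    where
    s′≈t′ : SameSet s′ t′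
    s′≈t′ = cap-same-front s′ t′ (trans s′₁≡w (sym t′₁≡w)) (trans Σs′≡Σs (trans eq (sym Σt′≡Σt)))

  cap-triples-disjoint : (s t : Triple C) → sumT s ≡ sumT t → ¬ SameSet s t →
                         {w w′ : Z2^ n} → w ∈T s → w′ ∈T t → w ≢ w′
  cap-triples-disjoint s t eq s≉t w∈s w′∈t refl = s≉t (cap-shared-point⇒SameSet s t w∈s w′∈t eq)

parity : ∀ {k} → (Fin k → Bool) → Bool
parity {zero}  λs = false
parity {suc k} λs = λs zero xor parity (λs ∘ suc)

lincomb-translate : ∀ {n k} (λs : Fin k → Bool) (q : Fin k → Z2^ n) (r : Z2^ n) →
                    lincomb λs (λ i → q i ⊕ r) ≡ (if parity λs then r else 𝟎) ⊕ lincomb λs q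
lincomb-translate {k = zero}  λs q r = sym (⊕-self 𝟎)
lincomb-translate {k = suc k} λs q r = begin
  (if b then q zero ⊕ r else 𝟎) ⊕ lincomb (λs ∘ suc) (λ i → q (suc i) ⊕ r)
    ≡⟨ cong₂ _⊕_ (if-⊕ b) (lincomb-translate (λs ∘ suc) (q ∘ suc) r) ⟩
  ((if b then q zero else 𝟎) ⊕ (if b then r else 𝟎)) ⊕ ((if P then r else 𝟎) ⊕ L)
    ≡⟨ ⊕-solve ((var 0F ⊞ var 1F) ⊞ (var 2F ⊞ var 3F)) ((var 1F ⊞ var 2F) ⊞ (var 0F ⊞ var 3F)) refl
               (lookup ((if b then q zero else 𝟎) ∷ (if b then r else 𝟎) ∷ (if P then r else 𝟎) ∷ L ∷ [])) ⟩
  ((if b then r else 𝟎) ⊕ (if P then r else 𝟎)) ⊕ ((if b then q zero else 𝟎) ⊕ L)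
    ≡⟨ cong (_⊕ ((if b then q zero else 𝟎) ⊕ L)) (sym (if-xor b P r)) ⟩
  (if b xor P then r else 𝟎) ⊕ ((if b then q zero else 𝟎) ⊕ L) ∎
  where
  open ≡-Reasoning
  b = λs zero
  P = parity (λs ∘ suc)
  L = lincomb (λs ∘ suc) (q ∘ suc)
  if-⊕ : ∀ c → (if c then q zero ⊕ r else 𝟎) ≡ (if c then q zero else 𝟎) ⊕ (if c then r else 𝟎)
  if-⊕ false = sym (⊕-self 𝟎)
  if-⊕ true  = refl

module _ {n : ℕ} {C : Subset n} (cap : IsCap C)
         (p : Fin 5 → Z2^ n) (p-injective : Injective _≡_ _≡_ p) (p∈C : ∀ i → C (p i)) where

  private
    apart : ∀ {i j} → i ≢ j → p i ≢ p j
    apart i≢j = i≢j ∘ p-injective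

    no-zero-pair : (i j : Fin 5) {_ : False (i ≟ᶠ j)} → lincomb (lookup (normalise (var i ⊞ var j))) p ≢ 𝟎
    no-zero-pair i j {i≢j} h = apart (toWitnessFalse i≢j) (⊕≡𝟎⇒≡ (trans (normalise-sound (var i ⊞ var j) p) h))

    no-zero-quad : (i j k l : Fin 5) {_ : True (allPairs? (λ a b → ¬? (a ≟ᶠ b)) (i ∷ j ∷ k ∷ l ∷ []))} →
                   lincomb (lookup (normalise (var i ⊞ var j ⊞ var k ⊞ var l))) p ≢ 𝟎
    no-zero-quad i j k l {distinct} h with toWitness distinct
    ... | (i≢j ∷ i≢k ∷ i≢l ∷ []) ∷ (j≢k ∷ j≢l ∷ []) ∷ (k≢l ∷ []) ∷ [] ∷ [] =
      cap (p i) (p j) (p k) (p l) (p∈C i) (p∈C j) (p∈C k) (p∈C l)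
          ( apart i≢j , apart i≢k , apart i≢l , apart j≢k , apart j≢l , apart k≢l
          , trans (normalise-sound (var i ⊞ var j ⊞ var k ⊞ var l) p) h)

    -- By lincomb-translate, a dependency among the pᵢ + p₀ is a vanishing sum of two or four of the pᵢ.
    even-zero-sum-trivial : (bs : Vec Bool 4) → lincomb (lookup (parity (lookup bs) ∷ bs)) p ≡ 𝟎 →
                            bs ≡ replicate 4 false
    even-zero-sum-trivial (false ∷ false ∷ false ∷ false ∷ []) h = refl
    even-zero-sum-trivial (false ∷ false ∷ false ∷ true  ∷ []) h = ⊥-elim (no-zero-pair 0F 4F h)
    even-zero-sum-trivial (false ∷ false ∷ true  ∷ false ∷ []) h = ⊥-elim (no-zero-pair 0F 3F h)
    even-zero-sum-trivial (false ∷ false ∷ true  ∷ true  ∷ []) h = ⊥-elim (no-zero-pair 3F 4F h)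
    even-zero-sum-trivial (false ∷ true  ∷ false ∷ false ∷ []) h = ⊥-elim (no-zero-pair 0F 2F h)
    even-zero-sum-trivial (false ∷ true  ∷ false ∷ true  ∷ []) h = ⊥-elim (no-zero-pair 2F 4F h)
    even-zero-sum-trivial (false ∷ true  ∷ true  ∷ false ∷ []) h = ⊥-elim (no-zero-pair 2F 3F h)
    even-zero-sum-trivial (false ∷ true  ∷ true  ∷ true  ∷ []) h = ⊥-elim (no-zero-quad 0F 2F 3F 4F h)
    even-zero-sum-trivial (true  ∷ false ∷ false ∷ false ∷ []) h = ⊥-elim (no-zero-pair 0F 1F h)
    even-zero-sum-trivial (true  ∷ false ∷ false ∷ true  ∷ []) h = ⊥-elim (no-zero-pair 1F 4F h)
    even-zero-sum-trivial (true  ∷ false ∷ true  ∷ false ∷ []) h = ⊥-elim (no-zero-pair 1F 3F h)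
    even-zero-sum-trivial (true  ∷ false ∷ true  ∷ true  ∷ []) h = ⊥-elim (no-zero-quad 0F 1F 3F 4F h)
    even-zero-sum-trivial (true  ∷ true  ∷ false ∷ false ∷ []) h = ⊥-elim (no-zero-pair 1F 2F h)
    even-zero-sum-trivial (true  ∷ true  ∷ false ∷ true  ∷ []) h = ⊥-elim (no-zero-quad 0F 1F 2F 4F h)
    even-zero-sum-trivial (true  ∷ true  ∷ true  ∷ false ∷ []) h = ⊥-elim (no-zero-quad 0F 1F 2F 3F h)
    even-zero-sum-trivial (true  ∷ true  ∷ true  ∷ true  ∷ []) h = ⊥-elim (no-zero-quad 1F 2F 3F 4F h)

  cap-five-points-affinely-independent : LinIndep (λ i → p (suc i) ⊕ p zero)
  cap-five-points-affinely-independent λs h i = begin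
    λs i                        ≡⟨ sym (lookup∘tabulate λs i) ⟩
    lookup (tabulate λs) i      ≡⟨ cong (λ bs → lookup bs i) (even-zero-sum-trivial (tabulate λs) zero-sum) ⟩
    lookup (replicate 4 false) i ≡⟨ lookup-replicate i false ⟩
    false                       ∎
    where
    open ≡-Reasoning
    zero-sum : (if parity λs then p zero else 𝟎) ⊕ lincomb λs (p ∘ suc) ≡ 𝟎
    zero-sum = trans (sym (lincomb-translate λs (p ∘ suc) (p zero))) h

module _ {n k : ℕ} {v : Z2^ n} {u : Fin k → Z2^ n} where

  InFlat-origin : InFlat v u v
  InFlat-origin = (λ _ → false) , sym (trans (cong (v ⊕_) (lincomb-false u)) (⊕-identityʳ v))

  InFlat-⊕₃ : {a b c : Z2^ n} → InFlat v u a → InFlat v u b → InFlat v u c → InFlat v u (a ⊕ b ⊕ c)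
  InFlat-⊕₃ (λa , refl) (λb , refl) (λc , refl) = (λ i → (λa i xor λb i) xor λc i) , (begin
    (v ⊕ La) ⊕ (v ⊕ Lb) ⊕ (v ⊕ Lc)
      ≡⟨ ⊕-solve ((var 0F ⊞ var 1F) ⊞ (var 0F ⊞ var 2F) ⊞ (var 0F ⊞ var 3F)) (var 0F ⊞ (var 1F ⊞ var 2F ⊞ var 3F))
                 refl (lookup (v ∷ La ∷ Lb ∷ Lc ∷ [])) ⟩
    v ⊕ (La ⊕ Lb ⊕ Lc)
      ≡⟨ cong (λ w → v ⊕ (w ⊕ Lc)) (sym (lincomb-xor λa λb u)) ⟩
    v ⊕ (lincomb (λ i → λa i xor λb i) u ⊕ Lc)
      ≡⟨ cong (v ⊕_) (sym (lincomb-xor (λ i → λa i xor λb i) λc u)) ⟩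
    v ⊕ lincomb (λ i → (λa i xor λb i) xor λc i) u ∎)
    where
    open ≡-Reasoning
    La = lincomb λa u
    Lb = lincomb λb u
    Lc = lincomb λc u

InFlat-vertex : ∀ {n k} {v : Z2^ n} (q : Fin k → Z2^ n) (i : Fin k) → InFlat v (λ j → q j ⊕ v) (q i)
InFlat-vertex {k = k} {v} q i = lookup (replicate k false [ i ]≔ true) , (begin
  q i               ≡⟨ ⊕-solve (var 1F) (var 0F ⊞ (var 1F ⊞ var 0F)) refl (lookup (v ∷ q i ∷ [])) ⟩
  v ⊕ (q i ⊕ v)     ≡⟨ cong (v ⊕_) (sym (lincomb-unit i (λ j → q j ⊕ v))) ⟩
  v ⊕ lincomb (lookup (replicate k false [ i ]≔ true)) (λ j → q j ⊕ v) ∎)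
  where open ≡-Reasoning

module _ {n : ℕ} {C : Subset n} (cap : IsCap C) where

  cap-repeated-sum⇒SixInFourFlat : (s t : Triple C) → sumT s ≡ sumT t → ¬ SameSet s t → SixInFourFlat C
  cap-repeated-sum⇒SixInFourFlat s@(triple x y z x∈ y∈ z∈ x≢y x≢z y≢z)
                                 t@(triple a b c a∈ b∈ c∈ a≢b a≢c b≢c) eq s≉t =
    x , u , independent , lookup qs , (λ {i} {j} → lookup-injective qs-unique i j) , lookup⁺ qs∈C , in-flat
    where
    qs : Vec (Z2^ n) 6
    qs = x ∷ y ∷ z ∷ a ∷ b ∷ c ∷ []

    apart : {w w′ : Z2^ n} → w ∈T s → w′ ∈T t → w ≢ w′
    apart = cap-triples-disjoint cap s t eq s≉t

    qs-unique : Unique qs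
    qs-unique = (x≢y ∷ x≢z ∷ apart 1st 1st ∷ apart 1st 2nd ∷ apart 1st 3rd ∷ [])
              ∷ (y≢z ∷ apart 2nd 1st ∷ apart 2nd 2nd ∷ apart 2nd 3rd ∷ [])
              ∷ (apart 3rd 1st ∷ apart 3rd 2nd ∷ apart 3rd 3rd ∷ [])
              ∷ (a≢b ∷ a≢c ∷ [])
              ∷ (b≢c ∷ [])
              ∷ [] ∷ []

    qs∈C : All C qs
    qs∈C = x∈ ∷ y∈ ∷ z∈ ∷ a∈ ∷ b∈ ∷ c∈ ∷ []

    q : Fin 4 → Z2^ n
    q i = lookup qs (suc (inject₁ i))

    u : Fin 4 → Z2^ n
    u i = q i ⊕ x

    independent : LinIndep u
    independent = cap-five-points-affinely-independent cap (lookup qs ∘ inject₁)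
      (λ {i} {j} e → inject₁-injective (lookup-injective qs-unique (inject₁ i) (inject₁ j) e))
      (λ i → lookup⁺ qs∈C (inject₁ i))

    c-from-rest : x ⊕ y ⊕ z ⊕ a ⊕ b ≡ c
    c-from-rest = begin
      x ⊕ y ⊕ z ⊕ a ⊕ b   ≡⟨ cong (λ w → w ⊕ a ⊕ b) eq ⟩
      a ⊕ b ⊕ c ⊕ a ⊕ b   ≡⟨ ⊕-solve (var 0F ⊞ var 1F ⊞ var 2F ⊞ var 0F ⊞ var 1F) (var 2F) refl
                                      (lookup (a ∷ b ∷ c ∷ [])) ⟩
      c                   ∎
      where open ≡-Reasoning

    in-flat : (i : Fin 6) → InFlat x u (lookup qs i)
    in-flat 0F = InFlat-origin {u = u}
    in-flat 1F = InFlat-vertex q 0F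
    in-flat 2F = InFlat-vertex q 1F
    in-flat 3F = InFlat-vertex q 2F
    in-flat 4F = InFlat-vertex q 3F
    in-flat 5F = subst (InFlat x u) c-from-rest
      (InFlat-⊕₃ {u = u} (InFlat-⊕₃ {u = u} (in-flat 0F) (in-flat 1F) (in-flat 2F)) (in-flat 3F) (in-flat 4F))

coefficient-code : ∀ {k} → (Fin k → Bool) → Fin (2 ^ k)
coefficient-code λs = funToFin (Inverse.from 2↔Bool ∘ λs)

coefficient-code-injective : ∀ {k} {λs μs : Fin k → Bool} →
                             coefficient-code λs ≡ coefficient-code μs → ∀ i → λs i ≡ μs i
coefficient-code-injective {λs = λs} {μs} eq i = begin
  λs i               ≡⟨ sym (strictlyInverseˡ (λs i)) ⟩
  to (from (λs i))   ≡⟨ cong to from-eq ⟩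
  to (from (μs i))   ≡⟨ strictlyInverseˡ (μs i) ⟩
  μs i               ∎
  where
  open ≡-Reasoning
  open Inverse 2↔Bool
  from-eq : from (λs i) ≡ from (μs i)
  from-eq = trans (sym (finToFun-funToFin (from ∘ λs) i))
                  (trans (cong (λ c → finToFun c i) eq) (finToFun-funToFin (from ∘ μs) i))

InFlat-pigeonhole : ∀ {n k m} {v : Z2^ n} {u : Fin k → Z2^ n} → 2 ^ k < m →
                    (w : Fin m → Z2^ n) → (∀ i → InFlat v u (w i)) → ∃₂ λ i j → i <ᶠ j × w i ≡ w j
InFlat-pigeonhole {v = v} {u} 2^k<m w w∈ with pigeonhole 2^k<m (coefficient-code ∘ proj₁ ∘ w∈)
... | i , j , i<j , same-code = i , j , i<j , (begin
  w i                           ≡⟨ proj₂ (w∈ i) ⟩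
  v ⊕ lincomb (proj₁ (w∈ i)) u  ≡⟨ cong (v ⊕_) (lincomb-cong u (coefficient-code-injective same-code)) ⟩
  v ⊕ lincomb (proj₁ (w∈ j)) u  ≡⟨ sym (proj₂ (w∈ j)) ⟩
  w j                           ∎)
  where open ≡-Reasoning

Index₃ : Set
Index₃ = Fin 6 × Fin 6 × Fin 6

_∈₃_ : Fin 6 → Index₃ → Set
m ∈₃ (i , j , k) = m ≡ i ⊎ m ≡ j ⊎ m ≡ k

Distinct₃ : Index₃ → Set
Distinct₃ (i , j , k) = i ≢ j × i ≢ k × j ≢ k

three-subsets : Vec Index₃ 20
three-subsets =
  (0F , 1F , 2F) ∷ (0F , 1F , 3F) ∷ (0F , 1F , 4F) ∷ (0F , 1F , 5F) ∷ (0F , 2F , 3F) ∷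
  (0F , 2F , 4F) ∷ (0F , 2F , 5F) ∷ (0F , 3F , 4F) ∷ (0F , 3F , 5F) ∷ (0F , 4F , 5F) ∷
  (1F , 2F , 3F) ∷ (1F , 2F , 4F) ∷ (1F , 2F , 5F) ∷ (1F , 3F , 4F) ∷ (1F , 3F , 5F) ∷
  (1F , 4F , 5F) ∷ (2F , 3F , 4F) ∷ (2F , 3F , 5F) ∷ (2F , 4F , 5F) ∷ (3F , 4F , 5F) ∷ []

-- abstract, so that the checker never unfolds these decided facts again
abstract
  three-subsets-distinct : (t : Fin 20) → Distinct₃ (lookup three-subsets t)
  three-subsets-distinct = toWitness {a? = all? λ t → let (i , j , k) = lookup three-subsets t in
    ¬? (i ≟ᶠ j) ×-dec ¬? (i ≟ᶠ k) ×-dec ¬? (j ≟ᶠ k)} _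

  three-subsets-separated : (t t′ : Fin 20) →
    t ≡ t′ ⊎ Σ (Fin 6) λ m → m ∈₃ lookup three-subsets t × ¬ m ∈₃ lookup three-subsets t′
  three-subsets-separated = toWitness {a? = all? λ t → all? λ t′ → (t ≟ᶠ t′) ⊎-dec
    any? λ m → (m ∈₃? lookup three-subsets t) ×-dec ¬? (m ∈₃? lookup three-subsets t′)} _
    where
    _∈₃?_ : (m : Fin 6) (τ : Index₃) → Dec (m ∈₃ τ)
    m ∈₃? (i , j , k) = (m ≟ᶠ i) ⊎-dec (m ≟ᶠ j) ⊎-dec (m ≟ᶠ k)

module _ {n : ℕ} {C : Subset n} {v : Z2^ n} {u : Fin 4 → Z2^ n} {pts : Fin 6 → Z2^ n}
         (pts-injective : Injective _≡_ _≡_ pts) (pts∈C : ∀ i → C (pts i)) where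

  private
    triple-of : (τ : Index₃) → Distinct₃ τ → Triple C
    triple-of (i , j , k) (i≢j , i≢k , j≢k) = triple (pts i) (pts j) (pts k) (pts∈C i) (pts∈C j) (pts∈C k)
      (i≢j ∘ pts-injective) (i≢k ∘ pts-injective) (j≢k ∘ pts-injective)

    ∈-triple-of : ∀ {m} τ d → m ∈₃ τ → pts m ∈T triple-of τ d
    ∈-triple-of _ _ = Sum.map (cong pts) (Sum.map (cong pts) (cong pts))

    ∈-triple-of⁻ : ∀ {m} τ d → pts m ∈T triple-of τ d → m ∈₃ τ
    ∈-triple-of⁻ _ _ = Sum.map pts-injective (Sum.map pts-injective pts-injective)

    triple-at : Fin 20 → Triple C
    triple-at t = triple-of (lookup three-subsets t) (three-subsets-distinct t)

    triple-at-injective : ∀ {t t′} → t ≢ t′ → ¬ SameSet (triple-at t) (triple-at t′)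
    triple-at-injective {t} {t′} t≢t′ (t⊆t′ , _) with three-subsets-separated t t′
    ... | inj₁ t≡t′ = t≢t′ t≡t′
    ... | inj₂ (m , m∈t , m∉t′) =
      m∉t′ (∈-triple-of⁻ _ (three-subsets-distinct t′)
             (t⊆t′ (pts m) (∈-triple-of _ (three-subsets-distinct t) m∈t)))

  six-points-in-flat⇒repeated-sum : (∀ i → InFlat v u (pts i)) → Σ (Z2^ n) (MultAtLeast2 C)
  six-points-in-flat⇒repeated-sum pts-in-flat =
    repeated-sum (InFlat-pigeonhole {v = v} {u = u} 2⁴<20 (sumT ∘ triple-at) sum-in-flat)
    where
    2⁴<20 : 2 ^ 4 < 20
    2⁴<20 = from-yes (2 ^ 4 <? 20)
    sum-in-flat : (t : Fin 20) → InFlat v u (sumT (triple-at t))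
    sum-in-flat t = InFlat-⊕₃ {u = u} (pts-in-flat _) (pts-in-flat _) (pts-in-flat _)
    repeated-sum : (∃₂ λ t t′ → t <ᶠ t′ × sumT (triple-at t) ≡ sumT (triple-at t′)) →
                   Σ (Z2^ n) (MultAtLeast2 C)
    repeated-sum (t , t′ , t<t′ , same-sum) =
      sumT (triple-at t) , triple-at t , triple-at t′ , refl , sym same-sum , triple-at-injective (<⇒≢ t<t′)

corollary5p19 : (n : ℕ) (C : Subset n) → IsCap C →
    (Σ (Z2^ n) (λ p → MultAtLeast2 C p) → SixInFourFlat C) ×
    (SixInFourFlat C → Σ (Z2^ n) (λ p → MultAtLeast2 C p))
corollary5p19 n C cap =
  (λ (_ , s , t , s-sum , t-sum , s≉t) →
     cap-repeated-sum⇒SixInFourFlat cap s t (trans s-sum (sym t-sum)) s≉t) ,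
  (λ (v , u , _ , pts , pts-injective , pts∈C , pts-in-flat) →
     six-points-in-flat⇒repeated-sum {v = v} {u} pts-injective pts∈C pts-in-flat)
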